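{- Let $\mathcal H_1,\dots,\mathcal H_k$ be $q$-uniform matchings on $[n]$ whose union $\mathcal H=\bigcup_i\mathcal H_i$ is $t$-approximately strongly regular, witnessed by the partition $\{\mathcal H^{(t)}_\theta\}_{\theta\in[p_t]}$ with sets $Q_\theta$. Then for every $b\in\{\pm1\}^k$, \[ \mathrm{val}(\Psi^{\mathcal H}_b)^2\le\frac{2|\mathcal H|^2}{d_t}+\frac{8|\mathcal H|}{d_t}\,\mathbb E_{L,R}\!\left[\mathrm{val}\big(f^{\mathcal H}_{L,R,t}\big)\right], \] where $L\sqcup R=[k]$ is a uniformly random partition (each $i\in[k]$ placed independently and uniformly in $L$ or $R$).
   Context: A $q$-uniform matching is a collection of pairwise disjoint $q$-subsets of $[n]$. $\mathcal H$ is the multiset union of the $\mathcal H_i$ (each hyperedge occurrence belongs to one matching), $|\mathcal H|=\sum_i|\mathcal H_i|$. For $x\in\{\pm1\}^n$ and $A\subseteq[n]$, $x_A=\prod_{u\in A}x_u$. $\Psi^{\mathcal H}_b(x)=\sum_{i=1}^k b_i\sum_{C\in\mathcal H_i}x_C$, $\mathrm{val}(\Psi^{\mathcal H}_b)=\max_{x\in\{\pm1\}^n}\Psi^{\mathcal H}_b(x)$. For a partition $L\sqcup R=[k]$, \[ f^{\mathcal H}_{L,R,t}(x)=\sum_{\theta\in[p_t]}\sum_{i\in L,\,j\in R}b_ib_j\sum_{C\in\mathcal H^{(t)}_\theta\cap\mathcal H_i,\ C'\in\mathcal H^{(t)}_\theta\cap\mathcal H_j}x_{C\setminus Q_\theta}\,x_{C'\setminus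 Q_\theta}, \] and $\mathrm{val}(f^{\mathcal H}_{L,R,t})=\max_{x\in\{\pm1\}^n}f^{\mathcal H}_{L,R,t}(x)$. Co-degrees: $d_{\mathcal H,Q}=|\{C\in\mathcal H:Q\subseteq C\}|$, $d_r=\max_{|Q|=r}d_{\mathcal H,Q}$. Good index: given $d_1\ge\cdots\ge d_q$, $t\in[q]$ is good if (1) $d_r/d_t\le n^{1-2r/q}$ for $1\le r\le\lceil\frac{q-t}{2}\rceil$; (2) $d_r/d_t\le n^{ -\frac{2}{q}(r-t)+\frac1q(t-\mathbf 1(t\text{ even}))}$ for $t\le r\le\lfloor\frac{q+t}{2}\rfloor$; (3) if $t<q/2$ then $d_t\ge d_1 n^{ -\frac2q(t-1)}$, and if $t>q/2$ then $d_t\ge d_1 n^{ -1+2/q}$. $t$-approximate strong regularity means there is a partition $\mathcal H=\mathcal H^{(t)}_1\sqcup\cdots\sqcup\mathcal H^{(t)}_{p_t}$ such that (i) each $\mathcal H^{(t)}_\theta$ has some $Q_\theta\in\binom{[n]}{t}$ contained in all its hyperedges; (ii) $d_t/2\le|\mathcal H^{(t)}_\theta|\le d_t$; (iii) $t$ is good with respect to $(d_1,\dots,d_q)$. -}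

module Defs where

open import Data.Bool using (Bool; true; false; if_then_else_; not; _∧_)
open import Data.Nat as ℕ using (ℕ; zero; suc; _≤_; _<_; _^_; ⌊_/2⌋; ⌈_/2⌉; _∸_)
open import Data.Integer as ℤ using (ℤ; +_; -[1+_]; _⊔_)
open import Data.Fin using (Fin; zero; suc)
import Data.Fin
open import Data.Fin.Subset using (Subset; inside; outside; _⊆_; _∩_; _─_; ∣_∣; ⊥)
open import Data.Fin.Subset.Properties using (_⊆?_)
open import Data.Vec using (Vec; []; _∷_)
open import Data.List using (List; length; lookup)
open import Data.Product using (_×_)
open import Relation.Nullary using (¬_; does)
open import Relation.Binary.PropositionalEquality using (_≡_)
import Data.Nat.Properties as ℕP

Σℕ : (m : ℕ) → (Fin m → ℕ) → ℕ
Σℕ zero    f = 0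
Σℕ (suc m) f = f zero ℕ.+ Σℕ m (λ i → f (suc i))

Σℤ : (m : ℕ) → (Fin m → ℤ) → ℤ
Σℤ zero    f = + 0
Σℤ (suc m) f = f zero ℤ.+ Σℤ m (λ i → f (suc i))

maxBoolFun : (m : ℕ) → ((Fin m → Bool) → ℤ) → ℤ
maxBoolFun zero    g = g (λ ())
maxBoolFun (suc m) g =
  maxBoolFun m (λ x → g (λ { zero → true  ; (suc i) → x i }))
  ⊔ maxBoolFun m (λ x → g (λ { zero → false ; (suc i) → x i }))

sumBoolFun : (m : ℕ) → ((Fin m → Bool) → ℤ) → ℤ
sumBoolFun zero    g = g (λ ())
sumBoolFun (suc m) g =
  sumBoolFun m (λ x → g (λ { zero → true  ; (suc i) → x i }))
  ℤ.+ sumBoolFun m (λ x → g (λ { zero → false ; (suc i) → x i }))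

maxSubset : (m : ℕ) → (Subset m → ℕ) → ℕ
maxSubset zero    g = g []
maxSubset (suc m) g =
  maxSubset m (λ A → g (inside ∷ A)) ℕ.⊔ maxSubset m (λ A → g (outside ∷ A))

-- x : Fin n → Bool encodes a point of {±1}^n (true ↦ +1, false ↦ -1)
sgn : Bool → ℤ
sgn true  = + 1
sgn false = ℤ.- (+ 1)

mono : {n : ℕ} → (Fin n → Bool) → Subset n → ℤ
mono {zero}  x []             = + 1
mono {suc n} x (inside  ∷ A)  = sgn (x zero) ℤ.* mono (λ i → x (suc i)) A
mono {suc n} x (outside ∷ A)  = mono (λ i → x (suc i)) A

Family : ℕ → ℕ → Set
Family n k = Fin k → List (Subset n)

IsQMatching : {n : ℕ} → ℕ → List (Subset n) → Set
IsQMatching q M =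
  ((a : Fin (length M)) → ∣ lookup M a ∣ ≡ q) ×
  ((a a' : Fin (length M)) → ¬ (a ≡ a') → (lookup M a ∩ lookup M a') ≡ ⊥)

-- |𝓗| = Σ_i |𝓗_i|  (multiset union)
size : {n k : ℕ} → Family n k → ℕ
size {k = k} H = Σℕ k (λ i → length (H i))

edge : {n k : ℕ} → (H : Family n k) → (i : Fin k) → Fin (length (H i)) → Subset n
edge H i a = lookup (H i) a

ind : Bool → ℕ
ind true  = 1
ind false = 0

codegQ : {n k : ℕ} → Family n k → Subset n → ℕ
codegQ {k = k} H Q = Σℕ k (λ i → Σℕ (length (H i)) (λ a → ind (does (Q ⊆? edge H i a))))

-- d_r = max_{|Q| = r} d_{𝓗,Q}   (0 if there is no r-subset)
codeg : {n k : ℕ} → Family n k → ℕ → ℕ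
codeg {n} H r = maxSubset n (λ Q → if does (∣ Q ∣ ℕ.≟ r) then codegQ H Q else 0)

-- RatioLe n q x y a  encodes  x ≤ y · n^{a/q}  (a ∈ ℤ, q ≥ 1), i.e.
-- x^q · n^{max(-a,0)} ≤ y^q · n^{max(a,0)}.
RatioLe : ℕ → ℕ → ℕ → ℕ → ℤ → Set
RatioLe n q x y (+ m)     = x ^ q ≤ (y ^ q) ℕ.* (n ^ m)
RatioLe n q x y -[1+ m ]  = (x ^ q) ℕ.* (n ^ suc m) ≤ y ^ q

evenInd : ℕ → ℕ
evenInd t = if does (t ℕ.% 2 ℕ.≟ 0) then 1 else 0

IsGood : (n q : ℕ) → (d : ℕ → ℕ) → ℕ → Set
IsGood n q d t =
  (1 ≤ t × t ≤ q) ×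
  -- (1)  d_r / d_t ≤ n^{1 - 2r/q} = n^{(q - 2r)/q}
  ((r : ℕ) → 1 ≤ r → r ≤ ⌈ q ∸ t /2⌉ →
     RatioLe n q (d r) (d t) (+ q ℤ.- + (2 ℕ.* r))) ×
  -- (2)  d_r / d_t ≤ n^{-(2/q)(r-t) + (1/q)(t - 1(t even))}
  ((r : ℕ) → t ≤ r → r ≤ ⌊ q ℕ.+ t /2⌋ →
     RatioLe n q (d r) (d t)
       ((ℤ.- (+ 2 ℤ.* (+ r ℤ.- + t))) ℤ.+ (+ t ℤ.- + evenInd t))) ×
  -- (3)  t < q/2 ⇒ d_t ≥ d_1 n^{-(2/q)(t-1)} ; t > q/2 ⇒ d_t ≥ d_1 n^{-1+2/q}
  ((2 ℕ.* t < q → RatioLe n q (d 1) (d t) (+ 2 ℤ.* (+ t ℤ.- + 1))) ×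
   (q < 2 ℕ.* t → RatioLe n q (d 1) (d t) (+ q ℤ.- + 2)))

-- A partition of the hyperedge occurrences into p parts is given by
-- part : (i : Fin k) → Fin (length (H i)) → Fin p, where part i a = θ means
-- occurrence a of 𝓗_i lies in 𝓗^{(t)}_θ, together with Qs : Fin p → Subset n.

Part : {n k : ℕ} → Family n k → ℕ → Set
Part {k = k} H p = (i : Fin k) → Fin (length (H i)) → Fin p

eqFin : {p : ℕ} → Fin p → Fin p → Bool
eqFin θ θ' = does (θ Data.Fin.≟ θ')

partSize : {n k p : ℕ} (H : Family n k) → Part H p → Fin p → ℕ
partSize {k = k} H part θ =
  Σℕ k (λ i → Σℕ (length (H i)) (λ a → ind (eqFin (part i a) θ)))

IsASR : {n k : ℕ} (q : ℕ) (H : Family n k) (t p : ℕ) → Part H p → (Fin p → Subset n) → Set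
IsASR {n} {k} q H t p part Qs =
  ((θ : Fin p) → ∣ Qs θ ∣ ≡ t) ×
  ((i : Fin k) (a : Fin (length (H i))) → Qs (part i a) ⊆ edge H i a) ×
  ((θ : Fin p) → codeg H t ≤ 2 ℕ.* partSize H part θ × partSize H part θ ≤ codeg H t) ×
  IsGood n q (codeg H) t

-- Ψ^𝓗_b(x) = Σ_i b_i Σ_{C ∈ 𝓗_i} x_C   (b : Fin k → Bool encodes {±1}^k)
Psi : {n k : ℕ} → Family n k → (Fin k → Bool) → (Fin n → Bool) → ℤ
Psi {k = k} H b x =
  Σℤ k (λ i → sgn (b i) ℤ.* Σℤ (length (H i)) (λ a → mono x (edge H i a)))

valPsi : {n k : ℕ} → Family n k → (Fin k → Bool) → ℤ
valPsi {n} H b = maxBoolFun n (Psi H b)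

-- f^𝓗_{L,R,t}(x); L : Fin k → Bool with L i = true iff i ∈ L (and R = complement)
fLR : {n k p : ℕ} → (H : Family n k) → Part H p → (Fin p → Subset n) →
      (Fin k → Bool) → (Fin k → Bool) → (Fin n → Bool) → ℤ
fLR {k = k} {p} H part Qs b L x =
  Σℤ p (λ θ → Σℤ k (λ i → Σℤ k (λ j →
    if L i ∧ not (L j)
    then sgn (b i) ℤ.* sgn (b j) ℤ.*
         Σℤ (length (H i)) (λ a → Σℤ (length (H j)) (λ a' →
           if eqFin (part i a) θ ∧ eqFin (part j a') θ
           then mono x (edge H i a ─ Qs θ) ℤ.* mono x (edge H j a' ─ Qs θ)
           else + 0))
    else + 0)))

valF : {n k p : ℕ} → (H : Family n k) → Part H p → (Fin p → Subset n) →
       (Fin k → Bool) → (Fin k → Bool) → ℤ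
valF {n} H part Qs b L = maxBoolFun n (fLR H part Qs b L)

-- Σ_{L ⊆ [k]} val(f^𝓗_{L,R,t}) ; the expectation is this divided by 2^k
sumValF : {n k p : ℕ} → (H : Family n k) → Part H p → (Fin p → Subset n) →
          (Fin k → Bool) → ℤ
sumValF {k = k} H part Qs b = sumBoolFun k (valF H part Qs b)

{-# OPTIONS --safe #-}
-- Split Ψ along the partition, Ψ = Σ_θ Ψ_θ with Ψ_θ the part of Ψ on 𝓗^{(t)}_θ.  Cauchy–Schwarz
-- gives Ψ² ≤ p_t Σ_θ Ψ_θ², and p_t d_t ≤ 2|𝓗| because every part has at least d_t/2 hyperedges.
-- All hyperedges of a part contain Q_θ and x_{Q_θ}² = 1, so Ψ_θ² is the sum of
-- b_i b_j x_{C∖Q_θ} x_{C′∖Q_θ} over pairs C ∈ 𝓗_i, C′ ∈ 𝓗_j in the part.  For i = j only C = C′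
-- survives, since two distinct edges of a matching cannot share the nonempty Q_θ; this contributes
-- |𝓗| in total.  A pair i ≠ j is separated (i ∈ L, j ∈ R) by exactly a quarter of the 2^k cuts,
-- so the remaining pairs sum to 4 𝔼_L f_{L,R,t}(x) ≤ 4 𝔼_L val(f_{L,R,t}).
module Submission where

open import Defs
open import Data.Nat using (ℕ; _^_)
open import Data.Integer using (ℤ; +_; _*_; _+_; _≤_)
open import Data.Fin using (Fin)
open import Data.Fin.Subset using (Subset)
open import Data.Bool using (Bool)

open import Data.Nat as ℕ using (zero; suc)
import Data.Nat.Properties as ℕP
open import Data.Integer using (-[1+_]; _-_; -_; +≤+; nonNegative)
open import Data.Integer.Properties hiding (_≟_)
open import Data.Integer.Tactic.RingSolver using (solve-∀)
import Algebra.Properties.CommutativeSemigroup as CommutativeSemigroupProperties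
open import Data.Fin using (zero; suc; _≟_)
open import Data.Fin.Subset using (inside; outside; _∈_; _⊆_; _─_; _∩_; ⊥; ∣_∣)
open import Data.Fin.Subset.Properties using (drop-∷-⊆; x∈p∩q⁺; p⊆q⇒∣p∣≤∣q∣; ∣⊥∣≡0)
open import Data.Bool using (true; false; not; _∧_; if_then_else_)
open import Data.List using (length)
open import Data.Vec using ([]; _∷_; here)
import Data.Vec.Functional as Vector
open import Data.Product using (∃; _,_; proj₁; proj₂)
open import Data.Sum using (inj₁; inj₂)
open import Data.Empty using (⊥-elim) renaming (⊥ to Empty)
open import Relation.Nullary using (¬_; yes; no)
open import Relation.Binary.Core using (_Preserves_⟶_)
open import Relation.Binary.PropositionalEquality

module +-CS = CommutativeSemigroupProperties +-commutativeSemigroup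
module *-CS = CommutativeSemigroupProperties *-commutativeSemigroup

ι : Bool → ℤ
ι c = + ind c

if≡ι* : ∀ c (v : ℤ) → (if c then v else + 0) ≡ ι c * v
if≡ι* true  v = sym (*-identityˡ v)
if≡ι* false v = refl

ι+ι-not≡1 : ∀ c → ι c + ι (not c) ≡ + 1
ι+ι-not≡1 true  = refl
ι+ι-not≡1 false = refl

eqFin⇒≡ : ∀ {p} {θ θ′ : Fin p} → eqFin θ θ′ ≡ true → θ ≡ θ′
eqFin⇒≡ {θ = θ} {θ′} eq with θ ≟ θ′
... | yes θ≡θ′ = θ≡θ′

Σℤ-cong : ∀ m {f g : Fin m → ℤ} → (∀ i → f i ≡ g i) → Σℤ m f ≡ Σℤ m g
Σℤ-cong zero    f≗g = refl
Σℤ-cong (suc m) f≗g = cong₂ _+_ (f≗g zero) (Σℤ-cong m (λ i → f≗g (suc i)))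

Σℤ-zero : ∀ m → Σℤ m (λ _ → + 0) ≡ + 0
Σℤ-zero zero    = refl
Σℤ-zero (suc m) = trans (+-identityˡ _) (Σℤ-zero m)

Σℤ-const : ∀ m c → Σℤ m (λ _ → c) ≡ + m * c
Σℤ-const zero    c = refl
Σℤ-const (suc m) c = begin
  c + Σℤ m (λ _ → c)    ≡⟨ cong (_+_ c) (Σℤ-const m c) ⟩
  c + + m * c           ≡⟨ cong (_+ + m * c) (*-identityˡ c) ⟨
  + 1 * c + + m * c     ≡⟨ *-distribʳ-+ c (+ 1) (+ m) ⟨
  (+ 1 + + m) * c       ≡⟨ cong (_* c) (pos-+ 1 m) ⟨
  + suc m * c           ∎
  where open ≡-Reasoning

Σℤ-distrib-+ : ∀ m (f g : Fin m → ℤ) → Σℤ m (λ i → f i + g i) ≡ Σℤ m f + Σℤ m g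
Σℤ-distrib-+ zero    f g = refl
Σℤ-distrib-+ (suc m) f g =
  trans (cong (_+_ (f zero + g zero)) (Σℤ-distrib-+ m _ _)) (+-CS.interchange (f zero) _ _ _)

*-distribˡ-Σℤ : ∀ m c (f : Fin m → ℤ) → c * Σℤ m f ≡ Σℤ m (λ i → c * f i)
*-distribˡ-Σℤ zero    c f = *-zeroʳ c
*-distribˡ-Σℤ (suc m) c f =
  trans (*-distribˡ-+ c (f zero) _) (cong (_+_ (c * f zero)) (*-distribˡ-Σℤ m c _))

*-distribʳ-Σℤ : ∀ m c (f : Fin m → ℤ) → Σℤ m f * c ≡ Σℤ m (λ i → f i * c)
*-distribʳ-Σℤ m c f =
  trans (*-comm _ c) (trans (*-distribˡ-Σℤ m c f) (Σℤ-cong m (λ i → *-comm c (f i))))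

Σℤ-comm : ∀ m l (f : Fin m → Fin l → ℤ) →
          Σℤ m (λ i → Σℤ l (f i)) ≡ Σℤ l (λ j → Σℤ m (λ i → f i j))
Σℤ-comm zero    l f = sym (Σℤ-zero l)
Σℤ-comm (suc m) l f =
  trans (cong (_+_ (Σℤ l (f zero))) (Σℤ-comm m l _)) (sym (Σℤ-distrib-+ l (f zero) _))

Σℤ-*-Σℤ : ∀ m l (f : Fin m → ℤ) (g : Fin l → ℤ) →
          Σℤ m f * Σℤ l g ≡ Σℤ m (λ i → Σℤ l (λ j → f i * g j))
Σℤ-*-Σℤ m l f g = trans (*-distribʳ-Σℤ m (Σℤ l g) f) (Σℤ-cong m (λ i → *-distribˡ-Σℤ l (f i) g))

Σℤ-mono-≤ : ∀ m {f g : Fin m → ℤ} → (∀ i → f i ≤ g i) → Σℤ m f ≤ Σℤ m g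
Σℤ-mono-≤ zero    f≤g = ≤-refl
Σℤ-mono-≤ (suc m) f≤g = +-mono-≤ (f≤g zero) (Σℤ-mono-≤ m (λ i → f≤g (suc i)))

pos-Σℕ : ∀ m (f : Fin m → ℕ) → + Σℕ m f ≡ Σℤ m (λ i → + f i)
pos-Σℕ zero    f = refl
pos-Σℕ (suc m) f = trans (pos-+ (f zero) _) (cong (_+_ (+ f zero)) (pos-Σℕ m _))

Σℤ-select : ∀ p (φ : Fin p) (g : Fin p → ℤ) → Σℤ p (λ θ → ι (eqFin φ θ) * g θ) ≡ g φ
Σℤ-select (suc p) zero    g = trans (cong₂ _+_ (*-identityˡ (g zero)) (Σℤ-zero p)) (+-identityʳ _)
Σℤ-select (suc p) (suc φ) g = trans (+-identityˡ _) (Σℤ-select p φ (λ θ → g (suc θ)))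

Σℤ-indicator : ∀ p (φ : Fin p) → Σℤ p (λ θ → ι (eqFin φ θ)) ≡ + 1
Σℤ-indicator p φ = trans (Σℤ-cong p (λ θ → sym (*-identityʳ _))) (Σℤ-select p φ (λ _ → + 1))

Σℤ-split-at : ∀ m (i : Fin m) (V : Fin m → ℤ) →
              Σℤ m V ≡ V i + Σℤ m (λ j → ι (not (eqFin i j)) * V j)
Σℤ-split-at m i V = begin
  Σℤ m V
    ≡⟨ Σℤ-cong m (λ j → trans (sym (*-identityˡ (V j)))
                              (cong (_* V j) (sym (ι+ι-not≡1 (eqFin i j))))) ⟩
  Σℤ m (λ j → (ι (eqFin i j) + ι (not (eqFin i j))) * V j)
    ≡⟨ Σℤ-cong m (λ j → *-distribʳ-+ (V j) (ι (eqFin i j)) (ι (not (eqFin i j)))) ⟩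
  Σℤ m (λ j → ι (eqFin i j) * V j + ι (not (eqFin i j)) * V j)
    ≡⟨ Σℤ-distrib-+ m _ _ ⟩
  Σℤ m (λ j → ι (eqFin i j) * V j) + Σℤ m (λ j → ι (not (eqFin i j)) * V j)
    ≡⟨ cong (_+ Σℤ m (λ j → ι (not (eqFin i j)) * V j)) (Σℤ-select m i V) ⟩
  V i + Σℤ m (λ j → ι (not (eqFin i j)) * V j) ∎
  where open ≡-Reasoning

0≤i*i : ∀ i → + 0 ≤ i * i
0≤i*i (+ zero)  = ≤-refl
0≤i*i (+ suc n) = +≤+ ℕ.z≤n
0≤i*i -[1+ n ]  = +≤+ ℕ.z≤n

0≤+m*+n : ∀ m n → + 0 ≤ + m * + n
0≤+m*+n m n = subst (+ 0 ≤_) (pos-* m n) (+≤+ ℕ.z≤n)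

0≤Σℤ-squares : ∀ m (f : Fin m → ℤ) → + 0 ≤ Σℤ m (λ i → f i * f i)
0≤Σℤ-squares m f =
  subst (_≤ Σℤ m (λ i → f i * f i)) (Σℤ-zero m) (Σℤ-mono-≤ m (λ i → 0≤i*i (f i)))

Σℤ-squared-deviations : ∀ m a (w : Fin m → ℤ) →
  Σℤ m (λ i → (a - w i) * (a - w i))
    ≡ + m * (a * a) + - (+ 2 * a) * Σℤ m w + Σℤ m (λ i → w i * w i)
Σℤ-squared-deviations m a w = begin
  Σℤ m (λ i → (a - w i) * (a - w i))
    ≡⟨ Σℤ-cong m (λ i → expand a (w i)) ⟩
  Σℤ m (λ i → a * a + - (+ 2 * a) * w i + w i * w i)
    ≡⟨ Σℤ-distrib-+ m _ _ ⟩
  Σℤ m (λ i → a * a + - (+ 2 * a) * w i) + Σℤ m (λ i → w i * w i)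
    ≡⟨ cong (_+ _) (Σℤ-distrib-+ m _ _) ⟩
  Σℤ m (λ _ → a * a) + Σℤ m (λ i → - (+ 2 * a) * w i) + Σℤ m (λ i → w i * w i)
    ≡⟨ cong₂ (λ u v → u + v + _) (Σℤ-const m (a * a)) (sym (*-distribˡ-Σℤ m (- (+ 2 * a)) w)) ⟩
  + m * (a * a) + - (+ 2 * a) * Σℤ m w + Σℤ m (λ i → w i * w i) ∎
  where
  open ≡-Reasoning
  expand : ∀ a y → (a - y) * (a - y) ≡ a * a + - (+ 2 * a) * y + y * y
  expand = solve-∀

cauchy-schwarz : ∀ m (w : Fin m → ℤ) → Σℤ m w * Σℤ m w ≤ + m * Σℤ m (λ i → w i * w i)
cauchy-schwarz zero    w = ≤-refl
cauchy-schwarz (suc m) w = begin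
  (a + S) * (a + S)
    ≤⟨ i≤i+j _ _ {{nonNegative 0≤slack}} ⟩
  (a + S) * (a + S) + (Σℤ m (λ i → (a - v i) * (a - v i)) + (+ m * Q - S * S))
    ≡⟨ cong (λ d → (a + S) * (a + S) + (d + (+ m * Q - S * S))) (Σℤ-squared-deviations m a v) ⟩
  (a + S) * (a + S) + (+ m * (a * a) + - (+ 2 * a) * S + Q + (+ m * Q - S * S))
    ≡⟨ lagrange a S Q (+ m) ⟩
  (+ 1 + + m) * (a * a + Q)
    ≡⟨ cong (_* (a * a + Q)) (pos-+ 1 m) ⟨
  + suc m * (a * a + Q) ∎
  where
  open ≤-Reasoning
  v : Fin m → ℤ
  v i = w (suc i)
  a S Q : ℤ
  a = w zero
  S = Σℤ m v
  Q = Σℤ m (λ i → v i * v i)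
  0≤slack : + 0 ≤ Σℤ m (λ i → (a - v i) * (a - v i)) + (+ m * Q - S * S)
  0≤slack = +-mono-≤ (0≤Σℤ-squares m (λ i → a - v i)) (i≤j⇒0≤j-i (cauchy-schwarz m v))
  lagrange : ∀ a S Q M → (a + S) * (a + S) + (M * (a * a) + - (+ 2 * a) * S + Q + (M * Q - S * S))
                         ≡ (+ 1 + M) * (a * a + Q)
  lagrange = solve-∀

pow2-suc-* : ∀ m x → + (2 ^ m) * x + + (2 ^ m) * x ≡ + (2 ^ suc m) * x
pow2-suc-* m x = trans (double (+ (2 ^ m)) x) (cong (_* x) (sym (pos-* 2 (2 ^ m))))
  where double : ∀ N x → N * x + N * x ≡ (+ 2 * N) * x
        double = solve-∀

sumBoolFun-cong : ∀ m {g h : (Fin m → Bool) → ℤ} → (∀ L → g L ≡ h L) →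
                  sumBoolFun m g ≡ sumBoolFun m h
sumBoolFun-cong zero    g≗h = g≗h _
sumBoolFun-cong (suc m) g≗h =
  cong₂ _+_ (sumBoolFun-cong m (λ _ → g≗h _)) (sumBoolFun-cong m (λ _ → g≗h _))

sumBoolFun-mono-≤ : ∀ m {g h : (Fin m → Bool) → ℤ} → (∀ L → g L ≤ h L) →
                    sumBoolFun m g ≤ sumBoolFun m h
sumBoolFun-mono-≤ zero    g≤h = g≤h _
sumBoolFun-mono-≤ (suc m) g≤h =
  +-mono-≤ (sumBoolFun-mono-≤ m (λ _ → g≤h _)) (sumBoolFun-mono-≤ m (λ _ → g≤h _))

sumBoolFun-homo : ∀ m (φ : ℤ → ℤ) → (∀ u v → φ (u + v) ≡ φ u + φ v) →
  ∀ g → φ (sumBoolFun m g) ≡ sumBoolFun m (λ L → φ (g L))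
sumBoolFun-homo zero    φ φ-+ g = refl
sumBoolFun-homo (suc m) φ φ-+ g =
  trans (φ-+ _ _) (cong₂ _+_ (sumBoolFun-homo m φ φ-+ _) (sumBoolFun-homo m φ φ-+ _))

sumBoolFun-*ʳ : ∀ m c (g : (Fin m → Bool) → ℤ) → sumBoolFun m (λ L → g L * c) ≡ sumBoolFun m g * c
sumBoolFun-*ʳ m c g = sym (sumBoolFun-homo m (_* c) (*-distribʳ-+ c) g)

sumBoolFun-Σℤ : ∀ m l (F : (Fin m → Bool) → Fin l → ℤ) →
  sumBoolFun m (λ L → Σℤ l (F L)) ≡ Σℤ l (λ e → sumBoolFun m (λ L → F L e))
sumBoolFun-Σℤ zero    l F = refl
sumBoolFun-Σℤ (suc m) l F =
  trans (cong₂ _+_ (sumBoolFun-Σℤ m l _) (sumBoolFun-Σℤ m l _)) (sym (Σℤ-distrib-+ l _ _))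

sumBoolFun-const : ∀ m c → sumBoolFun m (λ _ → c) ≡ + (2 ^ m) * c
sumBoolFun-const zero    c = sym (*-identityˡ c)
sumBoolFun-const (suc m) c =
  trans (cong₂ _+_ (sumBoolFun-const m c) (sumBoolFun-const m c)) (pow2-suc-* m c)

sumBoolFun-coordinate : ∀ m (j : Fin m) (g : Bool → ℤ) →
  + 2 * sumBoolFun m (λ L → g (L j)) ≡ + (2 ^ m) * (g true + g false)
sumBoolFun-coordinate (suc m) zero g = begin
  + 2 * (sumBoolFun m (λ _ → g true) + sumBoolFun m (λ _ → g false))
    ≡⟨ cong₂ (λ u v → + 2 * (u + v)) (sumBoolFun-const m (g true)) (sumBoolFun-const m (g false)) ⟩
  + 2 * (N * g true + N * g false)
    ≡⟨ split N (g true) (g false) ⟩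
  N * (g true + g false) + N * (g true + g false)
    ≡⟨ pow2-suc-* m (g true + g false) ⟩
  + (2 ^ suc m) * (g true + g false) ∎
  where
  open ≡-Reasoning
  N : ℤ
  N = + (2 ^ m)
  split : ∀ N a b → + 2 * (N * a + N * b) ≡ N * (a + b) + N * (a + b)
  split = solve-∀
sumBoolFun-coordinate (suc m) (suc j) g = begin
  + 2 * (S + S)                               ≡⟨ *-distribˡ-+ (+ 2) S S ⟩
  + 2 * S + + 2 * S                           ≡⟨ cong₂ _+_ IH IH ⟩
  + (2 ^ m) * c + + (2 ^ m) * c               ≡⟨ pow2-suc-* m c ⟩
  + (2 ^ suc m) * c                           ∎
  where
  open ≡-Reasoning
  S c : ℤ
  S = sumBoolFun m (λ L → g (L j))
  c = g true + g false
  IH : + 2 * S ≡ + (2 ^ m) * c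
  IH = sumBoolFun-coordinate m j g

combine-halves : ∀ m {A B u v : ℤ} → + 2 * A ≡ + (2 ^ m) * u → + 2 * B ≡ + (2 ^ m) * v →
                + 4 * (A + B) ≡ + (2 ^ suc m) * (u + v)
combine-halves m {A} {B} {u} {v} 2A≡ 2B≡ = begin
  + 4 * (A + B)                           ≡⟨ regroup A B ⟩
  + 2 * A + + 2 * A + (+ 2 * B + + 2 * B) ≡⟨ cong₂ (λ a b → a + a + (b + b)) 2A≡ 2B≡ ⟩
  N * u + N * u + (N * v + N * v)         ≡⟨ collect N u v ⟩
  N * (u + v) + N * (u + v)               ≡⟨ pow2-suc-* m (u + v) ⟩
  + (2 ^ suc m) * (u + v)                 ∎
  where
  open ≡-Reasoning
  N : ℤ
  N = + (2 ^ m)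
  regroup : ∀ A B → + 4 * (A + B) ≡ + 2 * A + + 2 * A + (+ 2 * B + + 2 * B)
  regroup = solve-∀
  collect : ∀ N u v → N * u + N * u + (N * v + N * v) ≡ N * (u + v) + N * (u + v)
  collect = solve-∀

sumBoolFun-separating : ∀ m (i j : Fin m) →
  + 4 * sumBoolFun m (λ L → ι (L i ∧ not (L j))) ≡ + (2 ^ m) * ι (not (eqFin i j))
sumBoolFun-separating (suc m) zero zero = begin
  + 4 * (Z + Z)          ≡⟨ cong (λ z → + 4 * (z + z)) Z≡0 ⟩
  + 0                    ≡⟨ *-zeroʳ (+ (2 ^ suc m)) ⟨
  + (2 ^ suc m) * + 0    ∎
  where
  open ≡-Reasoning
  Z : ℤ
  Z = sumBoolFun m (λ _ → + 0)
  Z≡0 : Z ≡ + 0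
  Z≡0 = trans (sumBoolFun-const m (+ 0)) (*-zeroʳ (+ (2 ^ m)))
sumBoolFun-separating (suc m) zero (suc j) =
  combine-halves m (sumBoolFun-coordinate m j (λ c → ι (not c)))
                   (sumBoolFun-coordinate m j (λ _ → + 0))
sumBoolFun-separating (suc m) (suc i) zero =
  combine-halves m (sumBoolFun-coordinate m i (λ c → ι (c ∧ false)))
                   (sumBoolFun-coordinate m i (λ c → ι (c ∧ true)))
sumBoolFun-separating (suc m) (suc i) (suc j) = begin
  + 4 * (S + S)                 ≡⟨ *-distribˡ-+ (+ 4) S S ⟩
  + 4 * S + + 4 * S             ≡⟨ cong₂ _+_ IH IH ⟩
  + (2 ^ m) * c + + (2 ^ m) * c ≡⟨ pow2-suc-* m c ⟩
  + (2 ^ suc m) * c             ∎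
  where
  open ≡-Reasoning
  S c : ℤ
  S = sumBoolFun m (λ L → ι (L i ∧ not (L j)))
  c = ι (not (eqFin i j))
  IH : + 4 * S ≡ + (2 ^ m) * c
  IH = sumBoolFun-separating m i j

sumBoolFun-if-separating : ∀ m (i j : Fin m) v →
  + 4 * sumBoolFun m (λ L → if L i ∧ not (L j) then v else + 0)
    ≡ + (2 ^ m) * (ι (not (eqFin i j)) * v)
sumBoolFun-if-separating m i j v = begin
  + 4 * sumBoolFun m (λ L → if L i ∧ not (L j) then v else + 0)
    ≡⟨ cong (+ 4 *_) (sumBoolFun-cong m (λ L → if≡ι* (L i ∧ not (L j)) v)) ⟩
  + 4 * sumBoolFun m (λ L → ι (L i ∧ not (L j)) * v)
    ≡⟨ cong (+ 4 *_) (sumBoolFun-*ʳ m v _) ⟩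
  + 4 * (S * v)                ≡⟨ *-assoc (+ 4) S v ⟨
  + 4 * S * v                  ≡⟨ cong (_* v) (sumBoolFun-separating m i j) ⟩
  + (2 ^ m) * c * v            ≡⟨ *-assoc (+ (2 ^ m)) c v ⟩
  + (2 ^ m) * (c * v)          ∎
  where
  open ≡-Reasoning
  S c : ℤ
  S = sumBoolFun m (λ L → ι (L i ∧ not (L j)))
  c = ι (not (eqFin i j))

*-sumBoolFun-Σℤ : ∀ m l c d {F : (Fin m → Bool) → Fin l → ℤ} {G : Fin l → ℤ} →
  (∀ e → c * sumBoolFun m (λ L → F L e) ≡ d * G e) →
  c * sumBoolFun m (λ L → Σℤ l (F L)) ≡ d * Σℤ l G
*-sumBoolFun-Σℤ m l c d {F} {G} termwise = begin
  c * sumBoolFun m (λ L → Σℤ l (F L))         ≡⟨ cong (c *_) (sumBoolFun-Σℤ m l F) ⟩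
  c * Σℤ l (λ e → sumBoolFun m (λ L → F L e)) ≡⟨ *-distribˡ-Σℤ l c _ ⟩
  Σℤ l (λ e → c * sumBoolFun m (λ L → F L e)) ≡⟨ Σℤ-cong l termwise ⟩
  Σℤ l (λ e → d * G e)                        ≡⟨ *-distribˡ-Σℤ l d G ⟨
  d * Σℤ l G                                  ∎
  where open ≡-Reasoning

-- maxBoolFun evaluates g at points built by pattern-matching lambdas, which agree with a given
-- x only pointwise; without function extensionality g must therefore respect _≗_.
maxBoolFun-upperBound : ∀ m {g : (Fin m → Bool) → ℤ} → g Preserves _≗_ ⟶ _≡_ →
                        ∀ x → g x ≤ maxBoolFun m g
maxBoolFun-upperBound zero    g-cong x = ≤-reflexive (g-cong (λ ()))
maxBoolFun-upperBound (suc m) g-cong x with x zero in x₀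
... | true  = ≤-trans (≤-reflexive (g-cong λ { zero → x₀ ; (suc i) → refl }))
                      (≤-trans (maxBoolFun-upperBound m
                                  (λ y≗z → g-cong (λ { zero → refl ; (suc i) → y≗z i }))
                                  (Vector.tail x))
                               (i≤i⊔j _ _))
... | false = ≤-trans (≤-reflexive (g-cong λ { zero → x₀ ; (suc i) → refl }))
                      (≤-trans (maxBoolFun-upperBound m
                                  (λ y≗z → g-cong (λ { zero → refl ; (suc i) → y≗z i }))
                                  (Vector.tail x))
                               (i≤j⊔i _ _))

maxBoolFun-attained : ∀ m {g : (Fin m → Bool) → ℤ} → g Preserves _≗_ ⟶ _≡_ →
                      ∃ λ x → maxBoolFun m g ≡ g x
maxBoolFun-attained zero    g-cong = (λ ()) , refl
maxBoolFun-attained (suc m) g-cong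
  with x₁ , max₁ ← maxBoolFun-attained m (λ y≗z → g-cong (λ { zero → refl ; (suc i) → y≗z i }))
     | x₂ , max₂ ← maxBoolFun-attained m (λ y≗z → g-cong (λ { zero → refl ; (suc i) → y≗z i }))
     with ⊔-sel (maxBoolFun m _) (maxBoolFun m _)
... | inj₁ max≡₁ = true Vector.∷ x₁ ,
                   trans max≡₁ (trans max₁ (g-cong λ { zero → refl ; (suc i) → refl }))
... | inj₂ max≡₂ = false Vector.∷ x₂ ,
                   trans max≡₂ (trans max₂ (g-cong λ { zero → refl ; (suc i) → refl }))

sgn*sgn≡1 : ∀ c → sgn c * sgn c ≡ + 1
sgn*sgn≡1 true  = refl
sgn*sgn≡1 false = refl

mono*mono≡1 : ∀ {n} (x : Fin n → Bool) A → mono x A * mono x A ≡ + 1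
mono*mono≡1 {zero}  x []            = refl
mono*mono≡1 {suc n} x (outside ∷ A) = mono*mono≡1 (Vector.tail x) A
mono*mono≡1 {suc n} x (inside ∷ A)  = begin
  s * m * (s * m)       ≡⟨ *-CS.interchange s m s m ⟩
  s * s * (m * m)       ≡⟨ cong₂ _*_ (sgn*sgn≡1 (x zero)) (mono*mono≡1 (Vector.tail x) A) ⟩
  + 1                   ∎
  where
  open ≡-Reasoning
  s m : ℤ
  s = sgn (x zero)
  m = mono (Vector.tail x) A

mono-cong : ∀ {n} {x y : Fin n → Bool} → x ≗ y → ∀ A → mono x A ≡ mono y A
mono-cong {zero}  x≗y []            = refl
mono-cong {suc n} x≗y (inside  ∷ A) =
  cong₂ _*_ (cong sgn (x≗y zero)) (mono-cong (λ i → x≗y (suc i)) A)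
mono-cong {suc n} x≗y (outside ∷ A) = mono-cong (λ i → x≗y (suc i)) A

mono-─ : ∀ {n} (x : Fin n → Bool) {Q C : Subset n} → Q ⊆ C →
         mono x C ≡ mono x Q * mono x (C ─ Q)
mono-─ {zero}  x {[]}          {[]}          Q⊆C = refl
mono-─ {suc n} x {outside ∷ Q} {outside ∷ C} Q⊆C = mono-─ (Vector.tail x) (drop-∷-⊆ Q⊆C)
mono-─ {suc n} x {outside ∷ Q} {inside  ∷ C} Q⊆C =
  trans (cong (sgn (x zero) *_) (mono-─ (Vector.tail x) (drop-∷-⊆ Q⊆C)))
        (*-CS.x∙yz≈y∙xz (sgn (x zero)) (mono (Vector.tail x) Q) (mono (Vector.tail x) (C ─ Q)))
mono-─ {suc n} x {inside  ∷ Q} {outside ∷ C} Q⊆C with () ← Q⊆C here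
mono-─ {suc n} x {inside  ∷ Q} {inside  ∷ C} Q⊆C =
  trans (cong (sgn (x zero) *_) (mono-─ (Vector.tail x) (drop-∷-⊆ Q⊆C)))
        (sym (*-assoc (sgn (x zero)) (mono (Vector.tail x) Q) (mono (Vector.tail x) (C ─ Q))))

mono-anchored : ∀ {n} (x : Fin n → Bool) {Q C C′ : Subset n} → Q ⊆ C → Q ⊆ C′ →
                mono x C * mono x C′ ≡ mono x (C ─ Q) * mono x (C′ ─ Q)
mono-anchored x {Q} {C} {C′} Q⊆C Q⊆C′ = begin
  mono x C * mono x C′            ≡⟨ cong₂ _*_ (mono-─ x Q⊆C) (mono-─ x Q⊆C′) ⟩
  mono x Q * D * (mono x Q * D′)  ≡⟨ *-CS.interchange (mono x Q) D (mono x Q) D′ ⟩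
  mono x Q * mono x Q * (D * D′)  ≡⟨ cong (_* (D * D′)) (mono*mono≡1 x Q) ⟩
  + 1 * (D * D′)                  ≡⟨ *-identityˡ (D * D′) ⟩
  D * D′                          ∎
  where
  open ≡-Reasoning
  D D′ : ℤ
  D  = mono x (C ─ Q)
  D′ = mono x (C′ ─ Q)

disjoint-⊆⇒∣p∣≡0 : ∀ {n} {p q r : Subset n} → q ∩ r ≡ ⊥ → p ⊆ q → p ⊆ r → ∣ p ∣ ≡ 0
disjoint-⊆⇒∣p∣≡0 {n} {p} q∩r≡⊥ p⊆q p⊆r = ℕP.n≤0⇒n≡0 (begin
  ∣ p ∣          ≤⟨ p⊆q⇒∣p∣≤∣q∣ (λ x∈p → subst (_ ∈_) q∩r≡⊥ (x∈p∩q⁺ (p⊆q x∈p , p⊆r x∈p))) ⟩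
  ∣ ⊥ {n = n} ∣  ≡⟨ ∣⊥∣≡0 n ⟩
  0              ∎)
  where open ℕP.≤-Reasoning

module _ {n k p : ℕ} (H : Family n k) (part : Part H p) (Qs : Fin p → Subset n) (b : Fin k → Bool)
  where

  private
    len : Fin k → ℕ
    len i = length (H i)

    s : Fin k → ℤ
    s i = sgn (b i)

  inPart : Fin p → (i : Fin k) → Fin (len i) → Bool
  inPart θ i a = eqFin (part i a) θ

  summand : (Fin n → Bool) → Fin p → (i : Fin k) → Fin (len i) → ℤ
  summand x θ i a = ι (inPart θ i a) * (s i * mono x (edge H i a))

  partPsi : (Fin n → Bool) → Fin p → ℤ
  partPsi x θ = Σℤ k (λ i → Σℤ (len i) (summand x θ i))

  pairTerm : (Fin n → Bool) → Fin p → (i j : Fin k) → Fin (len i) → Fin (len j) → ℤ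
  pairTerm x θ i j a a′ =
    if inPart θ i a ∧ inPart θ j a′
    then mono x (edge H i a ─ Qs θ) * mono x (edge H j a′ ─ Qs θ)
    else + 0

  crossTerm : (Fin n → Bool) → Fin p → Fin k → Fin k → ℤ
  crossTerm x θ i j = s i * s j * Σℤ (len i) (λ a → Σℤ (len j) (pairTerm x θ i j a))

  offDiagonal : (Fin n → Bool) → ℤ
  offDiagonal x =
    Σℤ p (λ θ → Σℤ k (λ i → Σℤ k (λ j → ι (not (eqFin i j)) * crossTerm x θ i j)))

  Psi≡Σ-partPsi : ∀ x → Psi H b x ≡ Σℤ p (partPsi x)
  Psi≡Σ-partPsi x = begin
    Psi H b x
      ≡⟨ Σℤ-cong k (λ i → *-distribˡ-Σℤ (len i) (s i) _) ⟩
    Σℤ k (λ i → Σℤ (len i) (λ a → t i a))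
      ≡⟨ Σℤ-cong k (λ i → Σℤ-cong (len i) (λ a → sym (Σℤ-select p (part i a) (λ _ → t i a)))) ⟩
    Σℤ k (λ i → Σℤ (len i) (λ a → Σℤ p (λ θ → summand x θ i a)))
      ≡⟨ Σℤ-cong k (λ i → Σℤ-comm (len i) p _) ⟩
    Σℤ k (λ i → Σℤ p (λ θ → Σℤ (len i) (summand x θ i)))
      ≡⟨ Σℤ-comm k p _ ⟩
    Σℤ p (partPsi x) ∎
    where
    open ≡-Reasoning
    t : (i : Fin k) → Fin (len i) → ℤ
    t i a = s i * mono x (edge H i a)

  pos-partSize : ∀ θ → + partSize H part θ ≡ Σℤ k (λ i → Σℤ (len i) (λ a → ι (inPart θ i a)))
  pos-partSize θ = trans (pos-Σℕ k _) (Σℤ-cong k (λ i → pos-Σℕ (len i) _))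

  Σ-inPart≡size : Σℤ p (λ θ → Σℤ k (λ i → Σℤ (len i) (λ a → ι (inPart θ i a)))) ≡ + size H
  Σ-inPart≡size = begin
    Σℤ p (λ θ → Σℤ k (λ i → Σℤ (len i) (λ a → ι (inPart θ i a))))
      ≡⟨ trans (Σℤ-comm p k _) (Σℤ-cong k (λ i → Σℤ-comm p (len i) _)) ⟩
    Σℤ k (λ i → Σℤ (len i) (λ a → Σℤ p (λ θ → ι (inPart θ i a))))
      ≡⟨ Σℤ-cong k (λ i → Σℤ-cong (len i) (λ a → Σℤ-indicator p (part i a))) ⟩
    Σℤ k (λ i → Σℤ (len i) (λ _ → + 1))
      ≡⟨ Σℤ-cong k (λ i → trans (Σℤ-const (len i) (+ 1)) (*-identityʳ (+ len i))) ⟩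
    Σℤ k (λ i → + len i)
      ≡⟨ pos-Σℕ k len ⟨
    + size H ∎
    where open ≡-Reasoning

  parts*codeg≤2*size : ∀ D → (∀ θ → D ℕ.≤ 2 ℕ.* partSize H part θ) → + p * + D ≤ + 2 * + size H
  parts*codeg≤2*size D D≤2|part| = begin
    + p * + D                              ≡⟨ Σℤ-const p (+ D) ⟨
    Σℤ p (λ _ → + D)                       ≤⟨ Σℤ-mono-≤ p D≤2*|part| ⟩
    Σℤ p (λ θ → + 2 * + partSize H part θ) ≡⟨ *-distribˡ-Σℤ p (+ 2) _ ⟨
    + 2 * Σℤ p (λ θ → + partSize H part θ) ≡⟨ cong (+ 2 *_) Σ-partSize≡size ⟩
    + 2 * + size H                         ∎
    where
    open ≤-Reasoning
    D≤2*|part| : ∀ θ → + D ≤ + 2 * + partSize H part θ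
    D≤2*|part| θ = subst (+ D ≤_) (pos-* 2 (partSize H part θ)) (+≤+ (D≤2|part| θ))
    Σ-partSize≡size : Σℤ p (λ θ → + partSize H part θ) ≡ + size H
    Σ-partSize≡size = trans (Σℤ-cong p pos-partSize) Σ-inPart≡size

  sumBoolFun-fLR≡offDiagonal : ∀ x →
    + 4 * sumBoolFun k (λ L → fLR H part Qs b L x) ≡ + (2 ^ k) * offDiagonal x
  sumBoolFun-fLR≡offDiagonal x =
    *-sumBoolFun-Σℤ k p (+ 4) (+ (2 ^ k)) λ θ →
    *-sumBoolFun-Σℤ k k (+ 4) (+ (2 ^ k)) λ i →
    *-sumBoolFun-Σℤ k k (+ 4) (+ (2 ^ k)) λ j →
    sumBoolFun-if-separating k i j (crossTerm x θ i j)

  Psi-cong : Psi H b Preserves _≗_ ⟶ _≡_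
  Psi-cong x≗y =
    Σℤ-cong k λ i → cong (s i *_) (Σℤ-cong (len i) λ a → mono-cong x≗y (edge H i a))

  fLR-cong : ∀ L → fLR H part Qs b L Preserves _≗_ ⟶ _≡_
  fLR-cong L x≗y =
    Σℤ-cong p λ θ → Σℤ-cong k λ i → Σℤ-cong k λ j →
    cong (λ v → if L i ∧ not (L j) then v else + 0) (
    cong (s i * s j *_) (Σℤ-cong (len i) λ a → Σℤ-cong (len j) λ a′ →
    cong (λ v → if inPart θ i a ∧ inPart θ j a′ then v else + 0)
         (cong₂ _*_ (mono-cong x≗y (edge H i a ─ Qs θ)) (mono-cong x≗y (edge H j a′ ─ Qs θ)))))

  module _ (anchored : ∀ i a → Qs (part i a) ⊆ edge H i a) where

    anchored-inPart : ∀ {θ i a} → inPart θ i a ≡ true → Qs θ ⊆ edge H i a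
    anchored-inPart {i = i} {a} a∈θ =
      subst (λ φ → Qs φ ⊆ edge H i a) (eqFin⇒≡ a∈θ) (anchored i a)

    summand-product : ∀ x θ i j a a′ →
      summand x θ i a * summand x θ j a′ ≡ s i * s j * pairTerm x θ i j a a′
    summand-product x θ i j a a′ with inPart θ i a in a∈θ | inPart θ j a′ in a′∈θ
    ... | false | _     = vanish (s i) (s j) (mono x (edge H i a)) (summand x θ j a′)
      where vanish : ∀ u v c d → + 0 * (u * c) * d ≡ u * v * + 0
            vanish = solve-∀
    ... | true  | false = vanish (s i) (s j) (mono x (edge H i a)) (mono x (edge H j a′))
      where vanish : ∀ u v c d → + 1 * (u * c) * (+ 0 * (v * d)) ≡ u * v * + 0
            vanish = solve-∀
    ... | true  | true  = begin
      + 1 * (s i * mono x (edge H i a)) * (+ 1 * (s j * mono x (edge H j a′)))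
        ≡⟨ regroup (s i) (s j) (mono x (edge H i a)) (mono x (edge H j a′)) ⟩
      s i * s j * (mono x (edge H i a) * mono x (edge H j a′))
        ≡⟨ cong (s i * s j *_) (mono-anchored x (anchored-inPart a∈θ) (anchored-inPart a′∈θ)) ⟩
      s i * s j * (mono x (edge H i a ─ Qs θ) * mono x (edge H j a′ ─ Qs θ)) ∎
      where
      open ≡-Reasoning
      regroup : ∀ u v c d → + 1 * (u * c) * (+ 1 * (v * d)) ≡ u * v * (c * d)
      regroup = solve-∀

    partPsi²≡Σ-crossTerm : ∀ x θ →
      partPsi x θ * partPsi x θ ≡ Σℤ k (λ i → Σℤ k (crossTerm x θ i))
    partPsi²≡Σ-crossTerm x θ = begin
      partPsi x θ * partPsi x θ
        ≡⟨ Σℤ-*-Σℤ k k F F ⟩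
      Σℤ k (λ i → Σℤ k (λ j → F i * F j))
        ≡⟨ Σℤ-cong k (λ i → Σℤ-cong k (λ j → Σℤ-*-Σℤ (len i) (len j) _ _)) ⟩
      Σℤ k (λ i → Σℤ k (λ j →
        Σℤ (len i) (λ a → Σℤ (len j) (λ a′ → summand x θ i a * summand x θ j a′))))
        ≡⟨ Σℤ-cong k (λ i → Σℤ-cong k (λ j → Σℤ-cong (len i) (λ a → Σℤ-cong (len j) (λ a′ →
             summand-product x θ i j a a′)))) ⟩
      Σℤ k (λ i → Σℤ k (λ j →
        Σℤ (len i) (λ a → Σℤ (len j) (λ a′ → s i * s j * pairTerm x θ i j a a′))))
        ≡⟨ Σℤ-cong k (λ i → Σℤ-cong k (λ j → pull-out i j)) ⟩
      Σℤ k (λ i → Σℤ k (crossTerm x θ i)) ∎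
      where
      open ≡-Reasoning
      F : Fin k → ℤ
      F i = Σℤ (len i) (summand x θ i)
      pull-out : ∀ i j → Σℤ (len i) (λ a → Σℤ (len j) (λ a′ → s i * s j * pairTerm x θ i j a a′))
                         ≡ crossTerm x θ i j
      pull-out i j =
        trans (Σℤ-cong (len i) (λ a → sym (*-distribˡ-Σℤ (len j) (s i * s j) (pairTerm x θ i j a))))
              (sym (*-distribˡ-Σℤ (len i) (s i * s j) _))

    module _ (disjoint : ∀ i (a a′ : Fin (len i)) → ¬ a ≡ a′ → edge H i a ∩ edge H i a′ ≡ ⊥)
             (Qs-nonempty : ∀ θ → 0 ℕ.< ∣ Qs θ ∣) where

      inPart-unique : ∀ {θ i a a′} → ¬ a ≡ a′ →
                      inPart θ i a ≡ true → inPart θ i a′ ≡ true → Empty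
      inPart-unique {θ} {i} {a} {a′} a≢a′ a∈θ a′∈θ =
        ℕP.<⇒≢ (Qs-nonempty θ) (sym (disjoint-⊆⇒∣p∣≡0 (disjoint i a a′ a≢a′)
                                                    (anchored-inPart a∈θ) (anchored-inPart a′∈θ)))

      pairTerm-diagonal : ∀ x θ i a a′ → pairTerm x θ i i a a′ ≡ ι (eqFin a a′) * ι (inPart θ i a)
      pairTerm-diagonal x θ i a a′ with a ≟ a′
      ... | yes refl with inPart θ i a
      ...   | true  = mono*mono≡1 x _
      ...   | false = refl
      pairTerm-diagonal x θ i a a′ | no a≢a′ with inPart θ i a in a∈θ | inPart θ i a′ in a′∈θ
      ...   | true  | true  = ⊥-elim (inPart-unique a≢a′ a∈θ a′∈θ)
      ...   | true  | false = refl
      ...   | false | _     = refl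

      crossTerm-diagonal : ∀ x θ i → crossTerm x θ i i ≡ Σℤ (len i) (λ a → ι (inPart θ i a))
      crossTerm-diagonal x θ i = begin
        s i * s i * Σℤ (len i) (λ a → Σℤ (len i) (pairTerm x θ i i a))
          ≡⟨ cong₂ _*_ (sgn*sgn≡1 (b i))
                       (Σℤ-cong (len i) (λ a → Σℤ-cong (len i) (pairTerm-diagonal x θ i a))) ⟩
        + 1 * Σℤ (len i) (λ a → Σℤ (len i) (λ a′ → ι (eqFin a a′) * ι (inPart θ i a)))
          ≡⟨ *-identityˡ _ ⟩
        Σℤ (len i) (λ a → Σℤ (len i) (λ a′ → ι (eqFin a a′) * ι (inPart θ i a)))
          ≡⟨ Σℤ-cong (len i) (λ a → Σℤ-select (len i) a (λ _ → ι (inPart θ i a))) ⟩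
        Σℤ (len i) (λ a → ι (inPart θ i a)) ∎
        where open ≡-Reasoning

      Σ-partPsi²≡size+offDiagonal : ∀ x →
        Σℤ p (λ θ → partPsi x θ * partPsi x θ) ≡ + size H + offDiagonal x
      Σ-partPsi²≡size+offDiagonal x = begin
        Σℤ p (λ θ → partPsi x θ * partPsi x θ)
          ≡⟨ Σℤ-cong p (partPsi²≡Σ-crossTerm x) ⟩
        Σℤ p (λ θ → Σℤ k (λ i → Σℤ k (crossTerm x θ i)))
          ≡⟨ Σℤ-cong p (λ θ → Σℤ-cong k (λ i → Σℤ-split-at k i (crossTerm x θ i))) ⟩
        Σℤ p (λ θ → Σℤ k (λ i → crossTerm x θ i i + offDiagonalRow θ i))
          ≡⟨ Σℤ-cong p (λ θ → Σℤ-distrib-+ k _ _) ⟩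
        Σℤ p (λ θ → Σℤ k (λ i → crossTerm x θ i i) + Σℤ k (offDiagonalRow θ))
          ≡⟨ Σℤ-distrib-+ p _ _ ⟩
        Σℤ p (λ θ → Σℤ k (λ i → crossTerm x θ i i)) + offDiagonal x
          ≡⟨ cong (_+ offDiagonal x) diagonal≡size ⟩
        + size H + offDiagonal x ∎
        where
        open ≡-Reasoning
        offDiagonalRow : Fin p → Fin k → ℤ
        offDiagonalRow θ i = Σℤ k (λ j → ι (not (eqFin i j)) * crossTerm x θ i j)
        diagonal≡size : Σℤ p (λ θ → Σℤ k (λ i → crossTerm x θ i i)) ≡ + size H
        diagonal≡size = trans (Σℤ-cong p (λ θ → Σℤ-cong k (crossTerm-diagonal x θ))) Σ-inPart≡size

      Psi²-bound : ∀ D → (∀ θ → D ℕ.≤ 2 ℕ.* partSize H part θ) → ∀ x →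
        (Psi H b x * Psi H b x) * (+ D * + (2 ^ k))
          ≤ (+ 2 * (+ size H * + size H)) * + (2 ^ k) + (+ 8 * + size H) * sumValF H part Qs b
      Psi²-bound D D≤2|part| x = begin
        Psi H b x * Psi H b x * (+ D * K)
          ≡⟨ cong (λ ψ → ψ * ψ * (+ D * K)) (Psi≡Σ-partPsi x) ⟩
        W * W * (+ D * K)
          ≤⟨ *-monoʳ-≤-nonNeg (+ D * K) {{nonNegative (0≤+m*+n D (2 ^ k))}}
                              (cauchy-schwarz p (partPsi x)) ⟩
        + p * S * (+ D * K)
          ≡⟨ *-CS.interchange (+ p) S (+ D) K ⟩
        + p * + D * (S * K)
          ≤⟨ *-monoʳ-≤-nonNeg (S * K) {{nonNegative 0≤S*K}} (parts*codeg≤2*size D D≤2|part|) ⟩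
        + 2 * N * (S * K)
          ≡⟨ cong (λ σ → + 2 * N * (σ * K)) (Σ-partPsi²≡size+offDiagonal x) ⟩
        + 2 * N * ((N + offDiagonal x) * K)
          ≡⟨ expand N (offDiagonal x) K ⟩
        + 2 * (N * N) * K + + 2 * N * (K * offDiagonal x)
          ≡⟨ cong (λ o → + 2 * (N * N) * K + + 2 * N * o) (sumBoolFun-fLR≡offDiagonal x) ⟨
        + 2 * (N * N) * K + + 2 * N * (+ 4 * F)
          ≡⟨ cong (_+_ (+ 2 * (N * N) * K)) (regroup N F) ⟩
        + 2 * (N * N) * K + + 8 * N * F
          ≤⟨ +-monoʳ-≤ (+ 2 * (N * N) * K)
                       (*-monoˡ-≤-nonNeg (+ 8 * N) {{nonNegative (0≤+m*+n 8 (size H))}} F≤Σ-valF) ⟩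
        + 2 * (N * N) * K + + 8 * N * sumValF H part Qs b ∎
        where
        open ≤-Reasoning
        K N W S F : ℤ
        K = + (2 ^ k)
        N = + size H
        W = Σℤ p (partPsi x)
        S = Σℤ p (λ θ → partPsi x θ * partPsi x θ)
        F = sumBoolFun k (λ L → fLR H part Qs b L x)
        0≤S*K : + 0 ≤ S * K
        0≤S*K = *-monoʳ-≤-nonNeg K (0≤Σℤ-squares p (partPsi x))
        F≤Σ-valF : F ≤ sumValF H part Qs b
        F≤Σ-valF = sumBoolFun-mono-≤ k (λ L → maxBoolFun-upperBound n (fLR-cong L) x)
        expand : ∀ N O K → + 2 * N * ((N + O) * K) ≡ + 2 * (N * N) * K + + 2 * N * (K * O)
        expand = solve-∀
        regroup : ∀ N F → + 2 * N * (+ 4 * F) ≡ + 8 * N * F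
        regroup = solve-∀

lemma4p10 : (n k q t p : ℕ) (H : Family n k) →
    ((i : Fin k) → IsQMatching q (H i)) →
    (part : Part H p) (Qs : Fin p → Subset n) →
    IsASR q H t p part Qs →
    (b : Fin k → Bool) →
    (valPsi H b * valPsi H b) * (+ (codeg H t) * + (2 ^ k))
      ≤ (+ 2 * (+ (size H) * + (size H))) * + (2 ^ k)
        + (+ 8 * + (size H)) * sumValF H part Qs b
lemma4p10 n k q t p H matchings part Qs (∣Q∣≡t , anchored , part-sizes , (1≤t , _) , _) b
  with x , valPsi≡Psi-x ← maxBoolFun-attained n (Psi-cong H part Qs b) =
  ≤-trans (≤-reflexive (cong (λ ψ → ψ * ψ * (+ codeg H t * + (2 ^ k))) valPsi≡Psi-x))
          (Psi²-bound H part Qs b anchored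
             (λ i → proj₂ (matchings i))
             (λ θ → subst (0 ℕ.<_) (sym (∣Q∣≡t θ)) 1≤t)
             (codeg H t) (λ θ → proj₁ (part-sizes θ)) x)
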